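{- Let $G'$ be a connected graph that contains an induced paw, and let $I$ be an independent set of $G'$. Let $E_+$ be a set of non-edges of $G'$ such that $G'+E_+$ is paw-free. If $E_+$ does not contain every non-edge $xy$ of $G'$ with $x\in I$ and $y\in N(I)$, then $E_+$ contains at least $|I|-1$ edges with both endpoints in $I$.
   Context: All graphs are finite, simple and undirected. A paw is the four-vertex graph consisting of a triangle together with one additional vertex adjacent to exactly one vertex of the triangle; a graph is paw-free if it has no induced paw. $G'+E_+$ is the graph on $V(G')$ with edge set $E(G')\cup E_+$. $N(I)=\bigcup_{x\in I}N(x)\setminus I$. -}

module Defs where

open import Data.Nat using (ℕ; zero; suc; _+_; _<ᵇ_)
open import Data.Bool using (Bool; true; false; _∧_; _∨_; if_then_else_)
open import Data.Fin using (Fin; toℕ)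
open import Data.Fin.Subset using (Subset; _∈_; _∉_)
open import Data.Vec using (lookup)
open import Data.List using (List; allFin; map)
open import Data.Nat.ListAction using (sum)
open import Data.Product using (Σ; _×_; ∃)
open import Relation.Binary.PropositionalEquality using (_≡_; refl; cong₂)
open import Relation.Nullary using (¬_)

record Graph (n : ℕ) : Set where
  field
    adj    : Fin n → Fin n → Bool
    sym    : ∀ x y → adj x y ≡ adj y x
    irrefl : ∀ x → adj x x ≡ false
open Graph public

Edge : ∀ {n} → Graph n → Fin n → Fin n → Set
Edge G x y = adj G x y ≡ true

NonEdge : ∀ {n} → Graph n → Fin n → Fin n → Set
NonEdge G x y = adj G x y ≡ false

data Reachable {n} (G : Graph n) : Fin n → Fin n → Set where
  here : ∀ {x} → Reachable G x x
  step : ∀ {x y z} → Edge G x y → Reachable G y z → Reachable G x z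

Connected : ∀ {n} → Graph n → Set
Connected {n} G = ∀ (x y : Fin n) → Reachable G x y

InducedPaw : ∀ {n} → Graph n → Fin n → Fin n → Fin n → Fin n → Set
InducedPaw G a b c d =
  ¬ a ≡ b × ¬ a ≡ c × ¬ a ≡ d × ¬ b ≡ c × ¬ b ≡ d × ¬ c ≡ d ×
  Edge G a b × Edge G b c × Edge G a c × Edge G c d ×
  NonEdge G a d × NonEdge G b d

HasInducedPaw : ∀ {n} → Graph n → Set
HasInducedPaw {n} G = Σ (Fin n) λ a → Σ (Fin n) λ b → Σ (Fin n) λ c → Σ (Fin n) λ d →
  InducedPaw G a b c d

PawFree : ∀ {n} → Graph n → Set
PawFree G = ¬ HasInducedPaw G

Independent : ∀ {n} → Graph n → Subset n → Set
Independent G I = ∀ x y → x ∈ I → y ∈ I → NonEdge G x y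

InNbhd : ∀ {n} → Graph n → Subset n → Fin n → Set
InNbhd {n} G I y = y ∉ I × Σ (Fin n) λ x → x ∈ I × Edge G x y

NonEdgeSet : ∀ {n} → Graph n → Graph n → Set
NonEdgeSet {n} G E₊ = ∀ (x y : Fin n) → Edge E₊ x y → NonEdge G x y

_+E_ : ∀ {n} → Graph n → Graph n → Graph n
_+E_ G E₊ = record
  { adj = λ x y → adj G x y ∨ adj E₊ x y
  ; sym = λ x y → cong2 (sym G x y) (sym E₊ x y)
  ; irrefl = λ x → cong2' (irrefl G x) (irrefl E₊ x)
  }
  where
  cong2 : ∀ {a b c d} → a ≡ c → b ≡ d → (a ∨ b) ≡ (c ∨ d)
  cong2 = cong₂ _∨_
  cong2' : ∀ {a b} → a ≡ false → b ≡ false → (a ∨ b) ≡ false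
  cong2' refl refl = refl

-- Number of (unordered) edges of H with both endpoints in I:
-- count pairs x,y with toℕ x < toℕ y, x,y ∈ I, xy ∈ E(H).
bit : Bool → ℕ
bit true = 1
bit false = 0

edgesInside : ∀ {n} → Graph n → Subset n → ℕ
edgesInside {n} H I =
  sum (map (λ x → sum (map (λ y →
    bit ((toℕ x <ᵇ toℕ y) ∧ lookup I x ∧ lookup I y ∧ adj H x y))
    (allFin n))) (allFin n))

-- Write H = G' + E₊. A connected paw-free graph containing a triangle is complete multipartite:
-- triangles spread along edges (a neighbour v of a vertex u on a triangle shares a neighbour
-- with u), so every vertex lies on one, and then for a fixed edge xy the property "adjacent to
-- x or to y" spreads along every path. So if the non-edge xy of G' (x ∈ I, x'y ∈ E(G'), x' ∈ I)
-- is also a non-edge of H, then x must be adjacent to x', and I meets two parts of H. Peeling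
-- off one vertex at a time, a set meeting two parts of a complete multipartite graph spans at
-- least |I| - 1 edges, and as I is independent in G' they all lie in E₊.
module Submission where

open import Defs
open import Data.Nat using (ℕ; _≤_; _∸_)
open import Data.Fin using (Fin)
open import Data.Fin.Subset using (Subset; _∈_; ∣_∣)
open import Relation.Nullary using (¬_)

open import Data.Nat using (zero; suc; _+_; _<ᵇ_; z≤n; s≤s; _≤?_)
open import Data.Nat.Properties
  using (≤-trans; ≤-reflexive; m≤m+n; m≤n+m; m≤n+m∸n; +-mono-≤; +-0-monoid)
open import Data.Fin using (zero; suc; toℕ)
open import Data.Bool using (Bool; true; false; _∧_; _∨_)
open import Data.Vec using ([]; _∷_; lookup; here; there)
open import Data.Vec.Properties using ([]=⇒lookup; lookup⇒[]=)
open import Data.List using (allFin; map; tabulate)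
open import Data.List.Properties using (map-tabulate; map-cong)
open import Data.Nat.ListAction using (sum)
open import Data.Product using (∃; ∃₂; _×_; _,_)
open import Data.Sum using (_⊎_; inj₁; inj₂)
open import Data.Empty using (⊥; ⊥-elim)
open import Function using (id; _∘_)
open import Relation.Binary.PropositionalEquality as ≡ using (_≡_; _≢_; refl; trans; cong; cong₂; subst)
open import Relation.Nullary using (yes; no; contradiction)
open import Algebra.Properties.Monoid.Sum +-0-monoid using (sum-cong-≗) renaming (sum to ∑)

private
  variable
    n : ℕ
    I : Subset n
    a b c d s u v w x x′ y : Fin n

sum-tabulate : (g : Fin n → ℕ) → sum (tabulate g) ≡ ∑ g
sum-tabulate {zero}  g = refl
sum-tabulate {suc n} g = cong (g zero +_) (sum-tabulate (g ∘ suc))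

sum-map-allFin : (g : Fin n → ℕ) → sum (map g (allFin n)) ≡ ∑ g
sum-map-allFin g = trans (cong sum (map-tabulate id g)) (sum-tabulate g)

sum-map-allFin² : (g : Fin n → Fin n → ℕ) →
  sum (map (λ x → sum (map (g x) (allFin n))) (allFin n)) ≡ ∑ λ x → ∑ (g x)
sum-map-allFin² {n} g =
  trans (sum-map-allFin λ x → sum (map (g x) (allFin n))) (sum-cong-≗ λ x → sum-map-allFin (g x))

≤-∑ : (g : Fin n → ℕ) (i : Fin n) → g i ≤ ∑ g
≤-∑ g zero    = m≤m+n _ _
≤-∑ g (suc i) = ≤-trans (≤-∑ (g ∘ suc) i) (m≤n+m _ _)

count : (Fin n → Bool) → Subset n → ℕ
count p J = ∑ λ y → bit (lookup J y ∧ p y)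

count-pos : {p : Fin n → Bool} {J : Subset n} → y ∈ J → p y ≡ true → 1 ≤ count p J
count-pos {y = y} y∈J py =
  ≤-trans (≤-reflexive (cong bit (≡.sym (cong₂ _∧_ ([]=⇒lookup y∈J) py)))) (≤-∑ _ y)

count-full⊎counterexample : (p : Fin n → Bool) (J : Subset n) →
  ∣ J ∣ ≤ count p J ⊎ ∃ λ y → y ∈ J × p y ≡ false
count-full⊎counterexample p [] = inj₁ z≤n
count-full⊎counterexample p (b ∷ J) with count-full⊎counterexample (p ∘ suc) J
... | inj₂ (y , y∈J , py) = inj₂ (suc y , there y∈J , py)
... | inj₁ full with b | p zero in p0
...   | false | _     = inj₁ full
...   | true  | true  = inj₁ (s≤s full)
...   | true  | false = inj₂ (zero , here , p0)

module EdgeProperties (H : Graph n) where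

  edge⊎nonEdge : (x y : Fin n) → Edge H x y ⊎ NonEdge H x y
  edge⊎nonEdge x y with adj H x y
  ... | true  = inj₁ refl
  ... | false = inj₂ refl

  edge⇒¬nonEdge : Edge H x y → ¬ NonEdge H x y
  edge⇒¬nonEdge e ne = contradiction (trans (≡.sym e) ne) λ ()

  edge-sym : Edge H x y → Edge H y x
  edge-sym {x} {y} e = trans (sym H y x) e

  nonEdge-sym : NonEdge H x y → NonEdge H y x
  nonEdge-sym {x} {y} ne = trans (sym H y x) ne

  edge⇒≢ : Edge H x y → x ≢ y
  edge⇒≢ {x} e refl = edge⇒¬nonEdge e (irrefl H x)

  edge-nonEdge⇒≢ : Edge H x y → NonEdge H x w → y ≢ w
  edge-nonEdge⇒≢ e ne refl = edge⇒¬nonEdge e ne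

DominatedBy : Graph n → Fin n → Fin n → Fin n → Set
DominatedBy H x y v = Edge H v x ⊎ Edge H v y

EdgesDominate : Graph n → Set
EdgesDominate {n} H = ∀ {x y} → Edge H x y → (v : Fin n) → DominatedBy H x y v

dropFirst : Graph (suc n) → Graph n
dropFirst H = record
  { adj    = λ x y → adj H (suc x) (suc y)
  ; sym    = λ x y → sym H (suc x) (suc y)
  ; irrefl = λ x → irrefl H (suc x)
  }

dropFirst-edgesDominate : (H : Graph (suc n)) → EdgesDominate H → EdgesDominate (dropFirst H)
dropFirst-edgesDominate H dom e v = dom e (suc v)

firstDegree : Graph (suc n) → Subset n → ℕ
firstDegree H I = count (adj H zero ∘ suc) I

AdjacentPairIn : Graph n → Subset n → Set
AdjacentPairIn H I = ∃₂ λ x y → x ∈ I × y ∈ I × Edge H x y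

-- For I = true ∷ J this unfolds definitionally to firstDegree H J + edgesInside′ (dropFirst H) J.
edgesInside′ : Graph n → Subset n → ℕ
edgesInside′ H I =
  ∑ λ x → ∑ λ y → bit ((toℕ x <ᵇ toℕ y) ∧ lookup I x ∧ lookup I y ∧ adj H x y)

edgesInside≡edgesInside′ : (H : Graph n) (I : Subset n) → edgesInside H I ≡ edgesInside′ H I
edgesInside≡edgesInside′ {n} H I = sum-map-allFin² {n} _

firstDegree-full⊎adjacentPairAfterFirst : (H : Graph (suc n)) → EdgesDominate H →
  AdjacentPairIn H (true ∷ I) →
  ∣ I ∣ ≤ firstDegree H I ⊎ (1 ≤ firstDegree H I × AdjacentPairIn (dropFirst H) I)
firstDegree-full⊎adjacentPairAfterFirst {I = I} H dom = split
  where
  open EdgeProperties H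

  Conclusion : Set
  Conclusion = ∣ I ∣ ≤ firstDegree H I ⊎ (1 ≤ firstDegree H I × AdjacentPairIn (dropFirst H) I)

  viaFirst : y ∈ I → Edge H zero (suc y) → Conclusion
  viaFirst {y} y∈I e with count-full⊎counterexample (adj H zero ∘ suc) I
  ... | inj₁ full = inj₁ full
  ... | inj₂ (z , z∈I , 0≁z) with dom e (suc z)
  ...   | inj₁ z0 = ⊥-elim (edge⇒¬nonEdge (edge-sym z0) 0≁z)
  ...   | inj₂ zy = inj₂ (count-pos y∈I e , z , y , z∈I , y∈I , zy)

  split : AdjacentPairIn H (true ∷ I) → Conclusion
  split (zero  , zero  , _         , _         , e) = ⊥-elim (edge⇒≢ e refl)
  split (zero  , suc y , _         , there y∈I , e) = viaFirst y∈I e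
  split (suc x , zero  , there x∈I , _         , e) = viaFirst x∈I (edge-sym e)
  split (suc x , suc y , there x∈I , there y∈I , e) with dom e zero
  ... | inj₁ 0x = inj₂ (count-pos x∈I 0x , x , y , x∈I , y∈I , e)
  ... | inj₂ 0y = inj₂ (count-pos y∈I 0y , x , y , x∈I , y∈I , e)

edgesInside′-lower : (H : Graph n) → EdgesDominate H → AdjacentPairIn H I → ∣ I ∣ ∸ 1 ≤ edgesInside′ H I
edgesInside′-lower {I = false ∷ I} H dom (suc x , suc y , there x∈I , there y∈I , e) =
  ≤-trans (edgesInside′-lower (dropFirst H) (dropFirst-edgesDominate H dom) (x , y , x∈I , y∈I , e))
          (m≤n+m _ _)
edgesInside′-lower {I = true ∷ I} H dom pair
  with firstDegree-full⊎adjacentPairAfterFirst H dom pair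
... | inj₁ full = ≤-trans full (m≤m+n _ _)
... | inj₂ (pos , pair′) =
  ≤-trans (m≤n+m∸n _ 1)
          (+-mono-≤ pos (edgesInside′-lower (dropFirst H) (dropFirst-edgesDominate H dom) pair′))

InTriangle : Graph n → Fin n → Set
InTriangle H v = ∃₂ λ s t → Edge H v s × Edge H v t × Edge H s t

module _ (H : Graph n) (pawFree : PawFree H) where
  open EdgeProperties H

  no-paw : Edge H a b → Edge H b c → Edge H a c → Edge H c d →
    NonEdge H a d → NonEdge H b d → ⊥
  no-paw ab bc ac cd ad bd = pawFree (_ , _ , _ , _ ,
    edge⇒≢ ab , edge⇒≢ ac , edge-nonEdge⇒≢ (edge-sym ab) bd , edge⇒≢ bc ,
    edge-nonEdge⇒≢ ab ad , edge⇒≢ cd , ab , bc , ac , cd , ad , bd)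

  common-neighbour : InTriangle H u → Edge H u v → ∃ λ s → Edge H u s × Edge H v s
  common-neighbour {v = v} (s , t , us , ut , st) uv with edge⊎nonEdge v s | edge⊎nonEdge v t
  ... | inj₁ vs   | _        = s , us , vs
  ... | inj₂ _    | inj₁ vt  = t , ut , vt
  ... | inj₂ v≁s  | inj₂ v≁t =
    ⊥-elim (no-paw st (edge-sym ut) (edge-sym us) uv (nonEdge-sym v≁s) (nonEdge-sym v≁t))

  triangle-spreads : InTriangle H u → Edge H u v → InTriangle H v
  triangle-spreads {u = u} tu uv with common-neighbour tu uv
  ... | s , us , vs = u , s , edge-sym uv , vs , us

  undominated-common-neighbour : Edge H x y → Edge H u x → Edge H u v → Edge H u s → Edge H v s →
    NonEdge H v x → NonEdge H v y → ⊥
  undominated-common-neighbour {x} {y} {u} {s = s} xy ux uv us vs v≁x v≁y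
    with edge⊎nonEdge u y
  ... | inj₁ uy = no-paw xy (edge-sym uy) (edge-sym ux) uv (nonEdge-sym v≁x) (nonEdge-sym v≁y)
  ... | inj₂ u≁y with edge⊎nonEdge x s
  ...   | inj₂ x≁s = no-paw vs (edge-sym us) (edge-sym uv) ux v≁x (nonEdge-sym x≁s)
  ...   | inj₁ xs with edge⊎nonEdge y s
  ...     | inj₂ y≁s = no-paw us (edge-sym xs) ux xy u≁y (nonEdge-sym y≁s)
  ...     | inj₁ ys = no-paw xy ys xs (edge-sym vs) (nonEdge-sym v≁x) (nonEdge-sym v≁y)

  domination-spreads : Edge H x y → InTriangle H u → Edge H u v →
    DominatedBy H x y u → DominatedBy H x y v
  domination-spreads {x} {y} {v = v} xy tu uv du with edge⊎nonEdge v x | edge⊎nonEdge v y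
  ... | inj₁ vx  | _        = inj₁ vx
  ... | inj₂ _   | inj₁ vy  = inj₂ vy
  ... | inj₂ v≁x | inj₂ v≁y with common-neighbour tu uv | du
  ...   | s , us , vs | inj₁ ux =
    ⊥-elim (undominated-common-neighbour xy ux uv us vs v≁x v≁y)
  ...   | s , us , vs | inj₂ uy =
    ⊥-elim (undominated-common-neighbour (edge-sym xy) uy uv us vs v≁y v≁x)

  triangle-along : InTriangle H u → Reachable H u v → InTriangle H v
  triangle-along tu here         = tu
  triangle-along tu (step uw wv) = triangle-along (triangle-spreads tu uw) wv

  domination-along : Edge H x y → (∀ w → InTriangle H w) → Reachable H v x → DominatedBy H x y v
  domination-along xy triangles here         = inj₂ xy
  domination-along xy triangles (step vw wx) =
    domination-spreads xy (triangles _) (edge-sym vw) (domination-along xy triangles wx)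

  connected-triangle⇒edgesDominate : Connected H → InTriangle H u → EdgesDominate H
  connected-triangle⇒edgesDominate connected tu xy v =
    domination-along xy (λ w → triangle-along tu (connected _ w)) (connected v _)

module _ (G E₊ : Graph n) where

  +E-edge : Edge G x y → Edge (G +E E₊) x y
  +E-edge {x} {y} e = cong (_∨ adj E₊ x y) e

  +E-nonEdge : NonEdge G x y → NonEdge E₊ x y → NonEdge (G +E E₊) x y
  +E-nonEdge = cong₂ _∨_

  +E-connected : Connected G → Connected (G +E E₊)
  +E-connected connected x y = reachable (connected x y)
    where
    reachable : Reachable G u v → Reachable (G +E E₊) u v
    reachable here       = here
    reachable (step e r) = step (+E-edge e) (reachable r)

  edgesInside-+E : Independent G I → edgesInside E₊ I ≡ edgesInside (G +E E₊) I
  edgesInside-+E {I = I} independent =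
    cong sum (map-cong (λ x → cong sum (map-cong (λ y → cong bit (inside x y)) (allFin _))) (allFin _))
    where
    inside : ∀ x y → (toℕ x <ᵇ toℕ y) ∧ lookup I x ∧ lookup I y ∧ adj E₊ x y
                   ≡ (toℕ x <ᵇ toℕ y) ∧ lookup I x ∧ lookup I y ∧ adj (G +E E₊) x y
    inside x y with lookup I x in ix | lookup I y in iy
    ... | false | _     = refl
    ... | true  | false = refl
    ... | true  | true
      rewrite independent x y (lookup⇒[]= x I ix) (lookup⇒[]= y I iy) = refl

edgesInside-lower : (H : Graph n) → EdgesDominate H → x ∈ I → x′ ∈ I → Edge H x′ y →
  NonEdge H x y → ∣ I ∣ ∸ 1 ≤ edgesInside H I
edgesInside-lower {I = I} H dom x∈I x′∈I x′y x≁y with dom x′y _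
... | inj₁ xx′ = subst (_ ≤_) (≡.sym (edgesInside≡edgesInside′ H I))
                       (edgesInside′-lower H dom (_ , _ , x∈I , x′∈I , xx′))
... | inj₂ xy  = ⊥-elim (EdgeProperties.edge⇒¬nonEdge H xy x≁y)

proposition15 : {n : ℕ} (G : Graph n) (I : Subset n) (E₊ : Graph n)
    → Connected G
    → HasInducedPaw G
    → Independent G I
    → NonEdgeSet G E₊
    → PawFree (G +E E₊)
    → ¬ (∀ (x y : Fin n) → x ∈ I → InNbhd G I y → NonEdge G x y → Edge E₊ x y)
    → ∣ I ∣ ∸ 1 ≤ edgesInside E₊ I
-- The last hypothesis provides no witness, so the argument runs by contradiction on the
-- decidable conclusion.
proposition15 G I E₊ connected (_ , b , c , _ , _ , _ , _ , _ , _ , _ , ab , bc , ac , _)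
  independent _ pawFree notAll with ∣ I ∣ ∸ 1 ≤? edgesInside E₊ I
... | yes bound = bound
... | no ¬bound = contradiction allCrossNonEdgesAdded notAll
  where
  dom : EdgesDominate (G +E E₊)
  dom = connected-triangle⇒edgesDominate (G +E E₊) pawFree (+E-connected G E₊ connected)
          (b , c , +E-edge G E₊ ab , +E-edge G E₊ ac , +E-edge G E₊ bc)

  allCrossNonEdgesAdded : ∀ x y → x ∈ I → InNbhd G I y → NonEdge G x y → Edge E₊ x y
  allCrossNonEdgesAdded x y x∈I (_ , x′ , x′∈I , x′y) x≁y
    with EdgeProperties.edge⊎nonEdge E₊ x y
  ... | inj₁ added   = added
  ... | inj₂ missing = contradiction
    (subst (_ ≤_) (≡.sym (edgesInside-+E G E₊ independent))
      (edgesInside-lower (G +E E₊) dom x∈I x′∈I (+E-edge G E₊ x′y) (+E-nonEdge G E₊ x≁y missing)))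
    ¬bound
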